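{- Let $p$ be an odd integer (not necessarily prime), let $s,t$ be integers with $1 \le s,t \le p-1$, and let $B = \{0,1,\dots,t-1\} \subseteq \mathbb{Z}_p$. Define \[ f(s,t) = \begin{cases} 0 & \text{if } 2t \le p-s+1,\\ \left\lfloor \frac{(s+2t-p)^2}{4}\right\rfloor & \text{if } p-s+2 \le 2t \le p+s-2,\\ s(2t-p) & \text{if } p+s-1 \le 2t,\end{cases} \qquad g(s,t) = \begin{cases} t^2 & \text{if } 2t \le s,\\ \left\lceil \frac{s(4t-s)}{4}\right\rceil & \text{if } s+1 \le 2t \le 2p-s-1,\\ s(2t-p)+(p-t)^2 & \text{if } 2p-s \le 2t.\end{cases} \] Then for every integer $r$ with $f(s,t) \le r \le g(s,t)$ there is a subset $A$ of $\mathbb{Z}_p$ with $|A| = s$ and $r(A,B,B) = r$.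
   Context: $\mathbb{Z}_p$ is the additive group of integers modulo $p$. $r(A,B,B)$ denotes the number of triples $(a,b,a+b)$ with $a\in A$, $b\in B$ and $a+b\in B$. -}

module Defs where

open import Data.Bool using (Bool; true; false; if_then_else_; _∧_)
open import Data.Nat using (ℕ; zero; suc; _+_; _*_; _∸_; _^_; _≤ᵇ_; _<ᵇ_; NonZero)
open import Data.Nat.DivMod using (_/_; _%_)
open import Data.Fin using (Fin; toℕ)
open import Data.Fin.Subset using (Subset)
open import Data.Vec using (lookup)
open import Data.List using (List; map; concatMap; allFin)
open import Data.Nat.ListAction using (sum)

-- Z_p is modelled as Fin p, with addition (toℕ a + toℕ b) % p.
-- A subset of Z_p is a Subset p (a Vec Bool p); membership a ∈ A is lookup A a ≡ true.

inB : {p : ℕ} → ℕ → Fin p → Bool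
inB t x = toℕ x <ᵇ t

-- r(A,B,B) with B = {0,...,t-1}: number of pairs (a,b) ∈ A × B with a+b ∈ B
-- (a triple (a,b,a+b) is determined by the pair (a,b)).
rABB : (p : ℕ) .{{_ : NonZero p}} → Subset p → ℕ → ℕ
rABB p A t =
  sum (concatMap (λ a → map (λ b →
         if lookup A a ∧ (toℕ b <ᵇ t) ∧ (((toℕ a + toℕ b) % p) <ᵇ t)
         then 1 else 0)
       (allFin p)) (allFin p))

-- f(s,t) for p odd, 1 ≤ s,t ≤ p-1.
--  case 1: 2t ≤ p-s+1  ⇔  2t + s ≤ p + 1
--  case 2: p-s+2 ≤ 2t ≤ p+s-2  (i.e. not case 1 and 2t + 2 ≤ p + s)
--  case 3: p+s-1 ≤ 2t
f : ℕ → ℕ → ℕ → ℕ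
f p s t =
  if (2 * t + s) ≤ᵇ (p + 1) then 0
  else if (2 * t + 2) ≤ᵇ (p + s) then ((s + 2 * t) ∸ p) ^ 2 / 4
  else s * (2 * t ∸ p)

-- g(s,t):
--  case 1: 2t ≤ s
--  case 2: s+1 ≤ 2t ≤ 2p-s-1  (i.e. not case 1 and 2t + s + 1 ≤ 2p);  ceil(x/4) = (x+3)/4
--  case 3: 2p-s ≤ 2t
g : ℕ → ℕ → ℕ → ℕ
g p s t =
  if (2 * t) ≤ᵇ s then t ^ 2
  else if (2 * t + s + 1) ≤ᵇ (2 * p) then (s * (4 * t ∸ s) + 3) / 4
  else s * (2 * t ∸ p) + (p ∸ t) ^ 2

-- For a ∈ ℤ_p let c(a) be the number of b ∈ B with a + b ∈ B, so that r(A,B,B) = Σ_{a ∈ A} c(a).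
-- Counting directly, c(a) = (t - a)₊ + (a + t - p)₊; this is invariant under a ↦ -a, and for a at
-- distance k from 0 it equals m + (τ - k)₊ with m = max(0, 2t - p) and τ = min(t, p - t).
-- Listing ℤ_p as 0, 1, -1, 2, -2, … turns c into the sequence d i = m + (τ - ⌈i/2⌉)₊, which
-- decreases by at most one per step. For such a sequence the sums over the "windows" made of an
-- initial block, one more element and a final block, of total size s, take every value between the
-- sum of the last s terms and the sum of the first s terms: sliding the single element sweeps out an
-- interval, and moving one element from the initial block to the final one joins consecutive
-- intervals. Finally Σ_{i<n} (τ - ⌈i/2⌉)₊ = nτ - ⌊n²/4⌋ for n ≤ 2τ (and τ² beyond) shows that the
-- first s terms sum to g(s,t) and the last s terms to f(s,t).

module Submission where

open import Data.Bool using (Bool; true; false; if_then_else_; _∧_)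
open import Data.Fin as Fin using (Fin; toℕ)
open import Data.Fin.Subset using (Subset; ∣_∣)
open import Data.List as List using (List; concatMap; allFin; _∷_; [])
open import Data.List.Properties using (map-tabulate)
open import Data.Nat
open import Data.Nat.DivMod using (_%_; _/_; m≡m%n+[m/n]*n; m%n<n; m<n⇒m%n≡m; [m+n]%n≡m%n;
                                   m*n/n≡m; m/n*n≤m; m<n⇒m/n≡0; +-distrib-/-∣ˡ; +-distrib-/-∣ʳ)
open import Data.Nat.Divisibility using (divides-refl)
open import Data.Nat.ListAction using (sum)
open import Data.Nat.ListAction.Properties using (sum-++)
open import Data.Nat.Properties
open import Algebra.Properties.CommutativeSemigroup +-commutativeSemigroup using (interchange; xy∙z≈xz∙y)
open import Data.Nat.Tactic.RingSolver using (solve; solve-∀)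
open import Data.Product using (Σ; ∃-syntax; _×_; _,_)
open import Data.Sum using (inj₁; inj₂)
open import Data.Vec using (tabulate; lookup)
open import Data.Vec.Properties using (lookup∘tabulate)
open import Function using (_∘_)
open import Relation.Binary.PropositionalEquality
open import Relation.Nullary using (¬_; yes; no; contradiction)
open import Relation.Nullary.Decidable using (dec-true; dec-false)
open import Relation.Nullary.Reflects using (ofʸ; ofⁿ)

open import Defs

∑ : ℕ → (ℕ → ℕ) → ℕ
∑ zero    F = 0
∑ (suc n) F = F 0 + ∑ n (F ∘ suc)

syntax ∑ n (λ i → e) = ∑[ i < n ] e

∑-cong : ∀ n {F G : ℕ → ℕ} → (∀ i → i < n → F i ≡ G i) → ∑ n F ≡ ∑ n G
∑-cong zero    F≗G = refl
∑-cong (suc n) F≗G = cong₂ _+_ (F≗G 0 z<s) (∑-cong n (λ i i<n → F≗G (suc i) (s<s i<n)))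

∑-+ : ∀ a b (F : ℕ → ℕ) → ∑ (a + b) F ≡ ∑ a F + ∑[ i < b ] F (a + i)
∑-+ zero    b F = refl
∑-+ (suc a) b F = trans (cong (F 0 +_) (∑-+ a b (F ∘ suc))) (sym (+-assoc (F 0) _ _))

∑-suc : ∀ n (F : ℕ → ℕ) → ∑ (suc n) F ≡ ∑ n F + F n
∑-suc zero    F = +-identityʳ (F 0)
∑-suc (suc n) F = trans (cong (F 0 +_) (∑-suc n (F ∘ suc))) (sym (+-assoc (F 0) _ _))

∑-const : ∀ n c → ∑[ _ < n ] c ≡ n * c
∑-const zero    c = refl
∑-const (suc n) c = cong (c +_) (∑-const n c)

∑-distrib-+ : ∀ n (F G : ℕ → ℕ) → ∑[ i < n ] (F i + G i) ≡ ∑ n F + ∑ n G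
∑-distrib-+ zero    F G = refl
∑-distrib-+ (suc n) F G = begin
  F 0 + G 0 + ∑[ i < n ] (F (suc i) + G (suc i))
    ≡⟨ cong (F 0 + G 0 +_) (∑-distrib-+ n (F ∘ suc) (G ∘ suc)) ⟩
  F 0 + G 0 + (∑ n (F ∘ suc) + ∑ n (G ∘ suc))
    ≡⟨ interchange (F 0) (G 0) _ _ ⟩
  F 0 + ∑ n (F ∘ suc) + (G 0 + ∑ n (G ∘ suc)) ∎
  where open ≡-Reasoning

∑-reverse : ∀ n (F : ℕ → ℕ) → ∑ n F ≡ ∑[ k < n ] F (n ∸ suc k)
∑-reverse zero    F = refl
∑-reverse (suc n) F = begin
  F 0 + ∑ n (F ∘ suc)
    ≡⟨ cong (F 0 +_) (∑-reverse n (F ∘ suc)) ⟩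
  F 0 + ∑[ k < n ] F (suc (n ∸ suc k))
    ≡⟨ +-comm (F 0) _ ⟩
  ∑[ k < n ] F (suc (n ∸ suc k)) + F 0
    ≡⟨ cong₂ _+_ (∑-cong n (λ k k<n → cong F (sym (+-∸-assoc 1 k<n))))
        (cong F (sym (n∸n≡0 n))) ⟩
  ∑[ k < n ] F (n ∸ k) + F (n ∸ n)
    ≡⟨ sym (∑-suc n (λ k → F (n ∸ k))) ⟩
  ∑[ k < suc n ] F (n ∸ k) ∎
  where open ≡-Reasoning

∑-pairs : ∀ h (F : ℕ → ℕ) → ∑ (h + h) F ≡ ∑[ k < h ] (F (k + k) + F (suc (k + k)))
∑-pairs zero    F = refl
∑-pairs (suc h) F = begin
  ∑ (suc (h + suc h)) F
    ≡⟨ cong (λ n → ∑ (suc n) F) (+-suc h h) ⟩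
  F 0 + (F 1 + ∑[ i < h + h ] F (2 + i))
    ≡⟨ sym (+-assoc (F 0) _ _) ⟩
  F 0 + F 1 + ∑[ i < h + h ] F (2 + i)
    ≡⟨ cong (F 0 + F 1 +_) (∑-pairs h (λ i → F (2 + i))) ⟩
  F 0 + F 1 + ∑[ k < h ] (F (2 + (k + k)) + F (3 + (k + k)))
    ≡⟨ cong (F 0 + F 1 +_) (∑-cong h (λ k _ → cong (λ y → F y + F (suc y)) (sym (double-suc k)))) ⟩
  F 0 + F 1 + ∑[ k < h ] (F (suc k + suc k) + F (suc (suc k + suc k))) ∎
  where
  open ≡-Reasoning
  double-suc : ∀ k → suc k + suc k ≡ 2 + (k + k)
  double-suc k = cong suc (+-suc k k)

∑-vanishing : ∀ {k n} (F : ℕ → ℕ) → k ≤ n → (∀ i → k ≤ i → F i ≡ 0) → ∑ n F ≡ ∑ k F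
∑-vanishing {k} F k≤n F≡0 with m≤n⇒∃[o]m+o≡n k≤n
... | e , refl = begin
  ∑ (k + e) F
    ≡⟨ ∑-+ k e F ⟩
  ∑ k F + ∑[ i < e ] F (k + i)
    ≡⟨ cong (∑ k F +_) (trans (∑-cong e (λ i _ → F≡0 (k + i) (m≤m+n k i))) (∑-const e 0)) ⟩
  ∑ k F + e * 0
    ≡⟨ cong (∑ k F +_) (*-zeroʳ e) ⟩
  ∑ k F + 0
    ≡⟨ +-identityʳ _ ⟩
  ∑ k F ∎
  where open ≡-Reasoning

suffixSum : (ℕ → ℕ) → ℕ → ℕ → ℕ
suffixSum F n k = ∑[ i < k ] F (n ∸ k + i)

suffixSum-suc : ∀ F {n k} → suc k ≤ n → suffixSum F n (suc k) ≡ F (n ∸ suc k) + suffixSum F n k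
suffixSum-suc F {n} {k} k<n = cong₂ _+_ (cong F (+-identityʳ _)) (∑-cong k (λ i _ → cong F shift))
  where
  shift : ∀ {i} → n ∸ suc k + suc i ≡ n ∸ k + i
  shift {i} = trans (+-suc _ i) (cong (_+ i) (sym (+-∸-assoc 1 k<n)))

∑-prefix+suffix : ∀ {k n} (F : ℕ → ℕ) → k ≤ n → ∑ (n ∸ k) F + suffixSum F n k ≡ ∑ n F
∑-prefix+suffix {k} {n} F k≤n = trans (sym (∑-+ (n ∸ k) k F)) (cong (λ x → ∑ x F) (m∸n+n≡m k≤n))

-- Sums over windows

when : Bool → ℕ → ℕ
when b x = if b then x else 0

-- window j a b is the indicator of {0,…,j-1} ∪ {j+a} ∪ {j+a+1+b, j+a+2+b, …}.
window : ℕ → ℕ → ℕ → ℕ → Bool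
window (suc j) a       b zero    = true
window (suc j) a       b (suc i) = window j a b i
window zero    (suc a) b zero    = false
window zero    (suc a) b (suc i) = window zero a b i
window zero    zero    b zero    = true
window zero    zero    b (suc i) = window zero b zero i

window-full : ∀ i → window zero zero zero i ≡ true
window-full zero    = refl
window-full (suc i) = window-full i

∑-window-gap : ∀ b k (F : ℕ → ℕ) → ∑[ i < b + k ] when (window zero b zero i) (F i) ≡ ∑[ i < k ] F (b + i)
∑-window-gap zero    k F = ∑-cong k (λ i _ → cong (λ β → when β (F i)) (window-full i))
∑-window-gap (suc b) k F = ∑-window-gap b k (F ∘ suc)

∑-window : ∀ j a b k (F : ℕ → ℕ) →
  ∑[ i < j + (a + suc (b + k)) ] when (window j a b i) (F i)
    ≡ ∑ j F + F (j + a) + ∑[ i < k ] F (j + (a + suc (b + i)))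
∑-window (suc j) a       b k F = begin
  F 0 + ∑[ i < j + (a + suc (b + k)) ] when (window j a b i) (F (suc i))
    ≡⟨ cong (F 0 +_) (∑-window j a b k (F ∘ suc)) ⟩
  F 0 + (∑ j (F ∘ suc) + F (suc (j + a)) + ∑[ i < k ] F (suc (j + (a + suc (b + i)))))
    ≡⟨ sym (+-assoc (F 0) _ _) ⟩
  F 0 + (∑ j (F ∘ suc) + F (suc (j + a))) + ∑[ i < k ] F (suc (j + (a + suc (b + i))))
    ≡⟨ cong (_+ ∑[ i < k ] F (suc (j + (a + suc (b + i))))) (sym (+-assoc (F 0) _ _)) ⟩
  F 0 + ∑ j (F ∘ suc) + F (suc (j + a)) + ∑[ i < k ] F (suc (j + (a + suc (b + i)))) ∎
  where open ≡-Reasoning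
∑-window zero    (suc a) b k F = ∑-window zero a b k (F ∘ suc)
∑-window zero    zero    b k F = cong (F 0 +_) (∑-window-gap b k (F ∘ suc))

record Window (n : ℕ) : Set where
  constructor mkWindow
  field
    j a b k : ℕ
    fits    : j + (a + suc (b + k)) ≡ n

∑-over : ∀ {n} → Window n → (ℕ → ℕ) → ℕ
∑-over {n} W F = ∑[ i < n ] when (window j a b i) (F i)
  where open Window W

∑-over-formula : ∀ {n} (W : Window n) F → let open Window W in
  ∑-over W F ≡ ∑ j F + F (j + a) + suffixSum F n k
∑-over-formula (mkWindow j a b k refl) F =
  trans (∑-window j a b k F) (cong (∑ j F + F (j + a) +_) (∑-cong k (λ i _ → cong F (index i))))
  where
  index : ∀ i → j + (a + suc (b + i)) ≡ j + (a + suc (b + k)) ∸ k + i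
  index i = begin
    j + (a + suc (b + i))          ≡⟨ solve (j ∷ a ∷ b ∷ i ∷ []) ⟩
    j + (a + suc b) + i            ≡⟨ cong (_+ i) (sym (m+n∸n≡m _ k)) ⟩
    j + (a + suc b) + k ∸ k + i    ≡⟨ cong (λ x → x ∸ k + i) (solve (j ∷ a ∷ b ∷ k ∷ [])) ⟩
    j + (a + suc (b + k)) ∸ k + i  ∎
    where open ≡-Reasoning

∑-over-size : ∀ {n} (W : Window n) → ∑-over W (λ _ → 1) ≡ Window.j W + suc (Window.k W)
∑-over-size W = begin
  ∑-over W (λ _ → 1)                 ≡⟨ ∑-over-formula W (λ _ → 1) ⟩
  ∑ j (λ _ → 1) + 1 + ∑[ _ < k ] 1   ≡⟨ cong₂ (λ x y → x + 1 + y) (trans (∑-const j 1) (*-identityʳ j))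
                                                                (trans (∑-const k 1) (*-identityʳ k)) ⟩
  j + 1 + k                          ≡⟨ +-assoc j 1 k ⟩
  j + suc k                          ∎
  where open Window W
        open ≡-Reasoning

SumWindow : (ℕ → ℕ) → (n s r : ℕ) → Set
SumWindow d n s r = Σ (Window n) λ W → ∑-over W (λ _ → 1) ≡ s × ∑-over W d ≡ r

SlowlyDescending : (ℕ → ℕ) → Set
SlowlyDescending d = ∀ i → d i ≤ suc (d (suc i))

intermediate-value : ∀ {d} → SlowlyDescending d → ∀ n j {v} → d (j + n) ≤ v → v ≤ d j →
  ∃[ a ] a ≤ n × d (j + a) ≡ v
intermediate-value {d} desc zero j {v} lo hi =
  0 , z≤n , ≤-antisym lo (subst (λ x → v ≤ d x) (sym (+-identityʳ j)) hi)
intermediate-value {d} desc (suc n) j {v} lo hi with v ≤? d (suc j)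
... | yes v≤ with intermediate-value desc n (suc j) (subst (λ x → d x ≤ v) (+-suc j n) lo) v≤
...   | a , a≤n , eq = suc a , s≤s a≤n , trans (cong d (+-suc j a)) eq
intermediate-value {d} desc (suc n) j {v} lo hi | no v≰ =
  0 , z≤n , ≤-antisym (subst (λ x → d x ≤ v) (sym (+-identityʳ j)) (≤-trans (desc j) (≰⇒> v≰)))
                      (subst (λ x → v ≤ d x) (sym (+-identityʳ j)) hi)

module WindowSums {d : ℕ → ℕ} (desc : SlowlyDescending d) (n : ℕ) where

  middle-element : ∀ {r} j k → j + suc k ≤ n →
    ∑ j d + d (n ∸ suc k) + suffixSum d n k ≤ r → r ≤ ∑ j d + d j + suffixSum d n k →
    SumWindow d n (j + suc k) r
  middle-element {r} j k jk≤n lo hi = window-at (intermediate-value desc gap j lower upper)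
    where
    gap = n ∸ suc k ∸ j
    outer = ∑ j d + suffixSum d n k
    j+gap : j + gap ≡ n ∸ suc k
    j+gap = m+[n∸m]≡n (m+n≤o⇒m≤o∸n j jk≤n)
    lo′ : d (n ∸ suc k) + outer ≤ r
    lo′ = subst (_≤ r) (trans (xy∙z≈xz∙y (∑ j d) _ _) (+-comm _ (d (n ∸ suc k)))) lo
    lower : d (j + gap) ≤ r ∸ outer
    lower = m+n≤o⇒m≤o∸n (d (j + gap)) (subst (λ x → d x + outer ≤ r) (sym j+gap) lo′)
    upper : r ∸ outer ≤ d j
    upper = m≤n+o⇒m∸n≤o r outer (subst (r ≤_) (xy∙z≈xz∙y (∑ j d) (d j) _) hi)
    window-at : ∃[ a ] a ≤ gap × d (j + a) ≡ r ∸ outer → SumWindow d n (j + suc k) r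
    window-at (a , a≤gap , eq) = W , ∑-over-size W , value
      where
      fits : j + (a + suc (gap ∸ a + k)) ≡ n
      fits = begin
        j + (a + suc (gap ∸ a + k))  ≡⟨ regroup j a (gap ∸ a) k ⟩
        j + (a + (gap ∸ a)) + suc k  ≡⟨ cong (λ x → j + x + suc k) (m+[n∸m]≡n a≤gap) ⟩
        j + gap + suc k              ≡⟨ cong (_+ suc k) j+gap ⟩
        n ∸ suc k + suc k            ≡⟨ m∸n+n≡m (≤-trans (m≤n+m (suc k) j) jk≤n) ⟩
        n                            ∎
        where
        open ≡-Reasoning
        regroup : ∀ j a c k → j + (a + suc (c + k)) ≡ j + (a + c) + suc k
        regroup = solve-∀
      W = mkWindow j a (gap ∸ a) k fits
      value : ∑-over W d ≡ r
      value = begin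
        ∑-over W d                                ≡⟨ ∑-over-formula W d ⟩
        ∑ j d + d (j + a) + suffixSum d n k       ≡⟨ xy∙z≈xz∙y (∑ j d) _ _ ⟩
        outer + d (j + a)                         ≡⟨ cong (outer +_) eq ⟩
        outer + (r ∸ outer)                       ≡⟨ m+[n∸m]≡n (≤-trans (m≤n+m outer (d (n ∸ suc k))) lo′) ⟩
        r                                         ∎
        where open ≡-Reasoning

  -- Starting from j = s, k = 0 and moving one element at a time from the initial block to the final
  -- one, the lower sum of each splitting is the upper sum of the next.
  window-sums-interpolate : ∀ {s r} → suc s ≤ n → suffixSum d n (suc s) ≤ r → r ≤ ∑ (suc s) d →
    SumWindow d n (suc s) r
  window-sums-interpolate {s} {r} s<n lo hi = shift s 0 (+-comm s 1) (subst (r ≤_) start hi)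
    where
    start : ∑ (suc s) d ≡ ∑ s d + d s + suffixSum d n 0
    start = trans (∑-suc s d) (sym (+-identityʳ _))
    shift : ∀ j k → j + suc k ≡ suc s → r ≤ ∑ j d + d j + suffixSum d n k →
      SumWindow d n (suc s) r
    shift j k jk≡ hi′ with ∑ j d + d (n ∸ suc k) + suffixSum d n k ≤? r
    ... | yes lo′ = subst (λ x → SumWindow d n x r) jk≡
                      (middle-element j k (subst (_≤ n) (sym jk≡) s<n) lo′ hi′)
    shift zero    k jk≡  hi′ | no lo̸ = contradiction (subst (_≤ r) all-right lo) lo̸
      where
      all-right : suffixSum d n (suc s) ≡ d (n ∸ suc k) + suffixSum d n k
      all-right = trans (cong (suffixSum d n) (sym jk≡)) (suffixSum-suc d (subst (_≤ n) (sym jk≡) s<n))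
    shift (suc j) k jk≡  hi′ | no lo̸ =
      shift j (suc k) (trans (+-suc j (suc k)) jk≡) (≤-trans (<⇒≤ (≰⇒> lo̸)) (≤-reflexive moved))
      where
      k<n : suc k ≤ n
      k<n = ≤-trans (m≤n+m (suc k) (suc j)) (subst (_≤ n) (sym jk≡) s<n)
      moved : ∑ (suc j) d + d (n ∸ suc k) + suffixSum d n k ≡ ∑ j d + d j + suffixSum d n (suc k)
      moved = begin
        ∑ (suc j) d + d (n ∸ suc k) + suffixSum d n k
          ≡⟨ cong (λ x → x + d (n ∸ suc k) + suffixSum d n k) (∑-suc j d) ⟩
        ∑ j d + d j + d (n ∸ suc k) + suffixSum d n k
          ≡⟨ +-assoc (∑ j d + d j) _ _ ⟩
        ∑ j d + d j + (d (n ∸ suc k) + suffixSum d n k)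
          ≡⟨ cong (∑ j d + d j +_) (sym (suffixSum-suc d k<n)) ⟩
        ∑ j d + d j + suffixSum d n (suc k) ∎
        where open ≡-Reasoning

-- Counting r(A,B,B)

<ᵇ-true : ∀ {m n} → m < n → (m <ᵇ n) ≡ true
<ᵇ-true {m} {n} = dec-true (m <? n)

<ᵇ-false : ∀ {m n} → n ≤ m → (m <ᵇ n) ≡ false
<ᵇ-false {m} {n} n≤m = dec-false (m <? n) (≤⇒≯ n≤m)

≤ᵇ-true : ∀ {m n} → m ≤ n → (m ≤ᵇ n) ≡ true
≤ᵇ-true {m} {n} = dec-true (m ≤? n)

≤ᵇ-false : ∀ {m n} → n < m → (m ≤ᵇ n) ≡ false
≤ᵇ-false {m} {n} n<m = dec-false (m ≤? n) (<⇒≱ n<m)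

<ᵇ-suc : ∀ m n → (m <ᵇ suc n) ≡ (m ≤ᵇ n)
<ᵇ-suc zero    n = refl
<ᵇ-suc (suc m) n = refl

fromPredicate : ∀ p → (ℕ → Bool) → Subset p
fromPredicate p Q = tabulate (Q ∘ toℕ)

∣fromPredicate∣ : ∀ p Q → ∣ fromPredicate p Q ∣ ≡ ∑[ x < p ] when (Q x) 1
∣fromPredicate∣ zero    Q = refl
∣fromPredicate∣ (suc p) Q with Q 0
... | true  = cong suc (∣fromPredicate∣ p (Q ∘ suc))
... | false = ∣fromPredicate∣ p (Q ∘ suc)

sum-concatMap : {A : Set} (f : A → List ℕ) (xs : List A) →
  sum (concatMap f xs) ≡ sum (List.map (sum ∘ f) xs)
sum-concatMap f []       = refl
sum-concatMap f (x ∷ xs) =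
  trans (sum-++ (f x) (concatMap f xs)) (cong (sum (f x) +_) (sum-concatMap f xs))

sum-allFin : ∀ n (f : Fin n → ℕ) (F : ℕ → ℕ) → (∀ a → f a ≡ F (toℕ a)) → sum (List.map f (allFin n)) ≡ ∑ n F
sum-allFin n f F f≗F = trans (cong sum (map-tabulate (λ x → x) f)) (sum-tabulate n f F f≗F)
  where
  sum-tabulate : ∀ n (f : Fin n → ℕ) (F : ℕ → ℕ) → (∀ a → f a ≡ F (toℕ a)) → sum (List.tabulate f) ≡ ∑ n F
  sum-tabulate zero    f F f≗F = refl
  sum-tabulate (suc n) f F f≗F =
    cong₂ _+_ (f≗F Fin.zero) (sum-tabulate n (f ∘ Fin.suc) (F ∘ suc) (f≗F ∘ Fin.suc))

shiftOverlap : (p t a : ℕ) .{{_ : NonZero p}} → ℕ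
shiftOverlap p t a = ∑[ b < p ] when ((b <ᵇ t) ∧ ((a + b) % p <ᵇ t)) 1

rABB-fromPredicate : ∀ p .{{_ : NonZero p}} Q t →
  rABB p (fromPredicate p Q) t ≡ ∑[ a < p ] when (Q a) (shiftOverlap p t a)
rABB-fromPredicate p Q t = trans (sum-concatMap _ (allFin p)) (sum-allFin p _ _ row)
  where
  row : ∀ a → sum (List.map (λ b → if lookup (fromPredicate p Q) a ∧ (toℕ b <ᵇ t) ∧ ((toℕ a + toℕ b) % p <ᵇ t)
                                     then 1 else 0) (allFin p))
            ≡ when (Q (toℕ a)) (shiftOverlap p t (toℕ a))
  row a rewrite lookup∘tabulate (Q ∘ toℕ) a with Q (toℕ a)
  ... | true  = sum-allFin p _ _ (λ _ → refl)
  ... | false = trans (sum-allFin p _ (λ _ → 0) (λ _ → refl)) (trans (∑-const p 0) (*-zeroʳ p))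

∑-when-<ᵇ : ∀ n K → ∑[ j < n ] when (j <ᵇ K) 1 ≡ n ⊓ K
∑-when-<ᵇ zero    K       = refl
∑-when-<ᵇ (suc n) zero    = trans (∑-const n 0) (*-zeroʳ n)
∑-when-<ᵇ (suc n) (suc K) = cong suc (∑-when-<ᵇ n K)

∑-when-≤ᵇ : ∀ n K → ∑[ j < n ] when (K ≤ᵇ j) 1 ≡ n ∸ K
∑-when-≤ᵇ n       zero    = trans (∑-const n 1) (*-identityʳ n)
∑-when-≤ᵇ zero    (suc K) = refl
∑-when-≤ᵇ (suc n) (suc K) = trans (∑-cong n (λ j _ → cong (λ β → when β 1) (<ᵇ-suc K j))) (∑-when-≤ᵇ n K)

wrap-around : ∀ p .{{_ : NonZero p}} {t a b} → a < p → b < t → t < p →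
  when ((a + b) % p <ᵇ t) 1 ≡ when (a + b <ᵇ t) 1 + when (p ≤ᵇ a + b) 1
wrap-around p {t} {a} {b} a<p b<t t<p with a + b <? p
... | yes a+b<p rewrite m<n⇒m%n≡m a+b<p | ≤ᵇ-false a+b<p = sym (+-identityʳ _)
... | no a+b≮p with m≤n⇒∃[o]m+o≡n (≮⇒≥ a+b≮p)
...   | x , p+x≡a+b = wrapped
  where
  x<t : x < t
  x<t = +-cancelˡ-< p x t (begin-strict
    p + x ≡⟨ p+x≡a+b ⟩
    a + b <⟨ +-monoˡ-< b a<p ⟩
    p + b <⟨ +-monoʳ-< p b<t ⟩
    p + t ∎)
    where open ≤-Reasoning
  wrapped : when ((a + b) % p <ᵇ t) 1 ≡ when (a + b <ᵇ t) 1 + when (p ≤ᵇ a + b) 1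
  wrapped rewrite <ᵇ-false (≤-trans (<⇒≤ t<p) (≮⇒≥ a+b≮p)) | ≤ᵇ-true (≮⇒≥ a+b≮p)
                | trans (cong (_% p) (trans (sym p+x≡a+b) (+-comm p x))) ([m+n]%n≡m%n x p)
                | m<n⇒m%n≡m (<-trans x<t t<p) | <ᵇ-true x<t = refl

shiftOverlap-closed : ∀ p .{{_ : NonZero p}} {t a} → a < p → t < p →
  shiftOverlap p t a ≡ (t ∸ a) + (a + t ∸ p)
shiftOverlap-closed p {t} {a} a<p t<p = begin
  shiftOverlap p t a
    ≡⟨ cong (λ n → ∑ n F) (sym (m+[n∸m]≡n (<⇒≤ t<p))) ⟩
  ∑ (t + (p ∸ t)) F
    ≡⟨ ∑-+ t (p ∸ t) F ⟩
  ∑ t F + ∑[ i < p ∸ t ] F (t + i)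
    ≡⟨ cong₂ _+_ inside outside ⟩
  ∑[ b < t ] (when (b <ᵇ t ∸ a) 1 + when (p ∸ a ≤ᵇ b) 1) + 0
    ≡⟨ +-identityʳ _ ⟩
  ∑[ b < t ] (when (b <ᵇ t ∸ a) 1 + when (p ∸ a ≤ᵇ b) 1)
    ≡⟨ ∑-distrib-+ t _ _ ⟩
  ∑[ b < t ] when (b <ᵇ t ∸ a) 1 + ∑[ b < t ] when (p ∸ a ≤ᵇ b) 1
    ≡⟨ cong₂ _+_ (∑-when-<ᵇ t (t ∸ a)) (∑-when-≤ᵇ t (p ∸ a)) ⟩
  t ⊓ (t ∸ a) + (t ∸ (p ∸ a))
    ≡⟨ cong₂ _+_ (m≥n⇒m⊓n≡n (m∸n≤m t a)) (∸-∸ t (<⇒≤ a<p)) ⟩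
  (t ∸ a) + (a + t ∸ p) ∎
  where
  open ≡-Reasoning
  F : ℕ → ℕ
  F b = when ((b <ᵇ t) ∧ ((a + b) % p <ᵇ t)) 1
  shift-< : ∀ a b t → (a + b <ᵇ t) ≡ (b <ᵇ t ∸ a)
  shift-< zero    b t       = refl
  shift-< (suc a) b zero    = refl
  shift-< (suc a) b (suc t) = shift-< a b t
  shift-≤ : ∀ a b p → a ≤ p → (p ≤ᵇ a + b) ≡ (p ∸ a ≤ᵇ b)
  shift-≤ zero    b p       _         = refl
  shift-≤ (suc a) b (suc p) (s≤s a≤p) = trans (<ᵇ-suc p (a + b)) (shift-≤ a b p a≤p)
  inside : ∑ t F ≡ ∑[ b < t ] (when (b <ᵇ t ∸ a) 1 + when (p ∸ a ≤ᵇ b) 1)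
  inside = ∑-cong t (λ b b<t → begin
    F b
      ≡⟨ cong (λ β → when (β ∧ ((a + b) % p <ᵇ t)) 1) (<ᵇ-true b<t) ⟩
    when ((a + b) % p <ᵇ t) 1
      ≡⟨ wrap-around p a<p b<t t<p ⟩
    when (a + b <ᵇ t) 1 + when (p ≤ᵇ a + b) 1
      ≡⟨ cong₂ (λ β γ → when β 1 + when γ 1) (shift-< a b t) (shift-≤ a b p (<⇒≤ a<p)) ⟩
    when (b <ᵇ t ∸ a) 1 + when (p ∸ a ≤ᵇ b) 1 ∎)
  outside : ∑[ i < p ∸ t ] F (t + i) ≡ 0
  outside = begin
    ∑[ i < p ∸ t ] F (t + i)
      ≡⟨ ∑-cong (p ∸ t) (λ i _ → cong (λ β → when (β ∧ ((a + (t + i)) % p <ᵇ t)) 1) (<ᵇ-false (m≤m+n t i))) ⟩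
    ∑[ _ < p ∸ t ] 0          ≡⟨ ∑-const (p ∸ t) 0 ⟩
    (p ∸ t) * 0               ≡⟨ *-zeroʳ (p ∸ t) ⟩
    0                         ∎
  ∸-∸ : ∀ t {a p} → a ≤ p → t ∸ (p ∸ a) ≡ a + t ∸ p
  ∸-∸ t {a} a≤p with m≤n⇒∃[o]m+o≡n a≤p
  ... | x , refl = trans (cong (t ∸_) (m+n∸m≡n a x)) (sym ([m+n]∸[m+o]≡n∸o a t x))

shiftOverlap-symmetric : ∀ p .{{_ : NonZero p}} {t K} → 0 < K → K < p → t < p →
  shiftOverlap p t (p ∸ K) ≡ shiftOverlap p t K
shiftOverlap-symmetric p {t} {K} 0<K K<p t<p
  rewrite shiftOverlap-closed p (∸-monoʳ-< 0<K (<⇒≤ K<p)) t<p | shiftOverlap-closed p K<p t<p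
  with m≤n⇒∃[o]m+o≡n (<⇒≤ K<p)
... | x , refl = begin
  (t ∸ (K + x ∸ K)) + (K + x ∸ K + t ∸ (K + x))  ≡⟨ cong (λ y → (t ∸ y) + (y + t ∸ (K + x))) (m+n∸m≡n K x) ⟩
  (t ∸ x) + (x + t ∸ (K + x))                    ≡⟨ cong ((t ∸ x) +_) (cancel x t K) ⟩
  (t ∸ x) + (t ∸ K)                              ≡⟨ +-comm (t ∸ x) (t ∸ K) ⟩
  (t ∸ K) + (t ∸ x)                              ≡⟨ cong ((t ∸ K) +_) (sym ([m+n]∸[m+o]≡n∸o K t x)) ⟩
  (t ∸ K) + (K + t ∸ (K + x))                    ∎
  where
  open ≡-Reasoning
  cancel : ∀ x t K → x + t ∸ (K + x) ≡ t ∸ K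
  cancel x t K = trans (cong (x + t ∸_) (+-comm K x)) ([m+n]∸[m+o]≡n∸o x t K)

-- t = m + τ with m = max(0, 2t - p) and τ = min(t, p - t); short is the case 2t < p
data Profile (p : ℕ) : (t m τ : ℕ) → Set where
  short : ∀ {t} → t + t < p → Profile p t 0 t
  long  : ∀ {m τ} → p ≡ m + (τ + τ) → Profile p (m + τ) m τ

profile-t≡m+τ : ∀ {p t m τ} → Profile p t m τ → t ≡ m + τ
profile-t≡m+τ (short _) = refl
profile-t≡m+τ (long _)  = refl

profile : ∀ h t → t ≤ h + h → ∃[ m ] ∃[ τ ] Profile (suc (h + h)) t m τ
profile h t t≤2h with t ≤? h
... | yes t≤h = 0 , t , short (s≤s (+-mono-≤ t≤h t≤h))
... | no  t≰h with m≤n⇒∃[o]m+o≡n (≰⇒> t≰h)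
...   | w , refl with m≤n⇒∃[o]m+o≡n (<⇒≤ (+-cancelˡ-< h w h t≤2h))
...     | τ , refl =
  suc (w + w) , τ , subst (λ t → Profile (suc (w + τ + (w + τ))) t (suc (w + w)) τ) (t≡ w τ) (long (p≡ w τ))
  where
  t≡ : ∀ w τ → suc (w + w) + τ ≡ suc (w + τ + w)
  t≡ = solve-∀
  p≡ : ∀ w τ → suc (w + τ + (w + τ)) ≡ suc (w + w) + (τ + τ)
  p≡ = solve-∀

m+m≤n+n⇒m≤n : ∀ {a b} → a + a ≤ b + b → a ≤ b
m+m≤n+n⇒m≤n {a} {b} 2a≤2b with a ≤? b
... | yes a≤b = a≤b
... | no  a≰b = contradiction 2a≤2b (<⇒≱ (+-mono-< (≰⇒> a≰b) (≰⇒> a≰b)))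

shiftOverlap-profile : ∀ {p} .{{_ : NonZero p}} {t m τ K} → Profile p t m τ → t < p → K + K < p →
  shiftOverlap p t K ≡ m + (τ ∸ K)
shiftOverlap-profile {p} {t} {K = K} (short 2t<p) t<p 2K<p = begin
  shiftOverlap p t K        ≡⟨ shiftOverlap-closed p (≤-<-trans (m≤m+n K K) 2K<p) t<p ⟩
  (t ∸ K) + (K + t ∸ p)     ≡⟨ cong ((t ∸ K) +_) (m≤n⇒m∸n≡0 (<⇒≤ K+t<p)) ⟩
  (t ∸ K) + 0               ≡⟨ +-identityʳ _ ⟩
  t ∸ K                     ∎
  where
  open ≡-Reasoning
  K+t<p : K + t < p
  K+t<p with ≤-total K t
  ... | inj₁ K≤t = ≤-<-trans (+-monoˡ-≤ t K≤t) 2t<p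
  ... | inj₂ t≤K = ≤-<-trans (+-monoʳ-≤ K t≤K) 2K<p
shiftOverlap-profile {t = .(m + τ)} {m} {τ} {K} (long refl) t<p 2K<p = begin
  shiftOverlap (m + (τ + τ)) (m + τ) K
    ≡⟨ shiftOverlap-closed (m + (τ + τ)) (≤-<-trans (m≤m+n K K) 2K<p) t<p ⟩
  (m + τ ∸ K) + (K + (m + τ) ∸ (m + (τ + τ)))
    ≡⟨ cong ((m + τ ∸ K) +_) excess ⟩
  (m + τ ∸ K) + (K ∸ τ)
    ≡⟨ split ⟩
  m + (τ ∸ K) ∎
  where
  open ≡-Reasoning
  excess : K + (m + τ) ∸ (m + (τ + τ)) ≡ K ∸ τ
  excess = trans (cong₂ _∸_ (+-comm K (m + τ)) (sym (+-assoc m τ τ))) ([m+n]∸[m+o]≡n∸o (m + τ) K τ)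
  K≤m+τ : K ≤ m + τ
  K≤m+τ = m+m≤n+n⇒m≤n (≤-trans (<⇒≤ 2K<p) (≤-trans (m≤m+n _ m) (≤-reflexive (sym (lemma m τ)))))
    where
    lemma : ∀ m τ → m + τ + (m + τ) ≡ m + (τ + τ) + m
    lemma = solve-∀
  split : (m + τ ∸ K) + (K ∸ τ) ≡ m + (τ ∸ K)
  split with ≤-total K τ
  ... | inj₁ K≤τ rewrite m≤n⇒m∸n≡0 K≤τ = trans (+-identityʳ _) (+-∸-assoc m K≤τ)
  ... | inj₂ τ≤K with m≤n⇒∃[o]m+o≡n τ≤K
  ...   | x , refl = begin
    (m + τ ∸ (τ + x)) + (τ + x ∸ τ)
      ≡⟨ cong₂ _+_ (trans (cong (_∸ (τ + x)) (+-comm m τ)) ([m+n]∸[m+o]≡n∸o τ m x)) (m+n∸m≡n τ x) ⟩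
    (m ∸ x) + x
      ≡⟨ m∸n+n≡m (+-cancelˡ-≤ τ x m (subst (τ + x ≤_) (+-comm m τ) K≤m+τ)) ⟩
    m
      ≡⟨ sym (+-identityʳ m) ⟩
    m + 0
      ≡⟨ cong (m +_) (sym (m≤n⇒m∸n≡0 τ≤K)) ⟩
    m + (τ ∸ (τ + x)) ∎

-- Listing ℤ_p by distance from 0

⌈n+n/2⌉≡n : ∀ n → ⌈ n + n /2⌉ ≡ n
⌈n+n/2⌉≡n n = +-cancelˡ-≡ n _ _ (begin
  n + ⌈ n + n /2⌉            ≡⟨ cong (_+ ⌈ n + n /2⌉) (n≡⌊n+n/2⌋ n) ⟩
  ⌊ n + n /2⌋ + ⌈ n + n /2⌉  ≡⟨ ⌊n/2⌋+⌈n/2⌉≡n (n + n) ⟩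
  n + n                      ∎)
  where open ≡-Reasoning

⌈1+n+n/2⌉≡1+n : ∀ n → ⌈ suc (n + n) /2⌉ ≡ suc n
⌈1+n+n/2⌉≡1+n n = cong suc (sym (n≡⌊n+n/2⌋ n))

weight : ℕ → ℕ → ℕ → ℕ
weight m τ i = m + (τ ∸ ⌈ i /2⌉)

weight-slowlyDescending : ∀ m τ → SlowlyDescending (weight m τ)
weight-slowlyDescending m τ i = begin
  m + (τ ∸ ⌈ i /2⌉)            ≤⟨ +-monoʳ-≤ m (∸-step τ ⌈ i /2⌉) ⟩
  m + suc (τ ∸ suc ⌈ i /2⌉)    ≤⟨ +-monoʳ-≤ m (s≤s (∸-monoʳ-≤ τ (s≤s (⌊n/2⌋≤⌈n/2⌉ i)))) ⟩
  m + suc (τ ∸ ⌈ suc i /2⌉)    ≡⟨ +-suc m _ ⟩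
  suc (m + (τ ∸ ⌈ suc i /2⌉))  ∎
  where
  open ≤-Reasoning
  ∸-step : ∀ τ x → τ ∸ x ≤ suc (τ ∸ suc x)
  ∸-step zero    x       = ≤-trans (≤-reflexive (0∸n≡0 x)) z≤n
  ∸-step (suc τ) zero    = ≤-refl
  ∸-step (suc τ) (suc x) = ∸-step τ x

-- the position of x in the listing 0, 1, p-1, 2, p-2, … of ℤ_p, p = 2h+1, by distance from 0
distanceRank : ℕ → ℕ → ℕ
distanceRank h zero    = zero
distanceRank h (suc a) = if a <ᵇ h then suc (a + a) else (h + h ∸ a) + (h + h ∸ a)

distanceRank-lower : ∀ {h a} → a < h → distanceRank h (suc a) ≡ suc (a + a)
distanceRank-lower a<h rewrite <ᵇ-true a<h = refl

distanceRank-upper : ∀ {h a} → h ≤ a → distanceRank h (suc a) ≡ (h + h ∸ a) + (h + h ∸ a)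
distanceRank-upper h≤a rewrite <ᵇ-false h≤a = refl

∑-distanceRank : ∀ h (F : ℕ → ℕ) → ∑[ x < suc (h + h) ] F (distanceRank h x) ≡ ∑ (suc (h + h)) F
∑-distanceRank h F = cong (F 0 +_) (begin
  ∑[ a < h + h ] F (distanceRank h (suc a))
    ≡⟨ ∑-+ h h _ ⟩
  ∑[ a < h ] F (distanceRank h (suc a)) + ∑[ i < h ] F (distanceRank h (suc (h + i)))
    ≡⟨ cong₂ _+_ (∑-cong h (λ a a<h → cong F (distanceRank-lower a<h)))
                 (trans (∑-cong h (λ i _ → cong F (upper i))) (∑-reverse h _)) ⟩
  ∑[ k < h ] F (suc (k + k)) + ∑[ k < h ] F ((h ∸ (h ∸ suc k)) + (h ∸ (h ∸ suc k)))
    ≡⟨ cong (∑[ k < h ] F (suc (k + k)) +_) (∑-cong h (λ k k<h →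
         cong F (trans (cong (λ y → y + y) (m∸[m∸n]≡n k<h)) (cong suc (+-suc k k))))) ⟩
  ∑[ k < h ] F (suc (k + k)) + ∑[ k < h ] F (suc (suc (k + k)))
    ≡⟨ sym (∑-distrib-+ h _ _) ⟩
  ∑[ k < h ] (F (suc (k + k)) + F (suc (suc (k + k))))
    ≡⟨ sym (∑-pairs h (F ∘ suc)) ⟩
  ∑[ i < h + h ] F (suc i) ∎)
  where
  open ≡-Reasoning
  upper : ∀ i → distanceRank h (suc (h + i)) ≡ (h ∸ i) + (h ∸ i)
  upper i = trans (distanceRank-upper (m≤m+n h i)) (cong (λ y → y + y) ([m+n]∸[m+o]≡n∸o h h i))

shiftOverlap-distanceRank : ∀ h {t m τ x} → Profile (suc (h + h)) t m τ → t < suc (h + h) → x < suc (h + h) →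
  shiftOverlap (suc (h + h)) t x ≡ weight m τ (distanceRank h x)
shiftOverlap-distanceRank h {x = zero} prof t<p _ = shiftOverlap-profile {K = 0} prof t<p z<s
shiftOverlap-distanceRank h {t} {m} {τ} {suc a} prof t<p (s≤s a<2h) with a <? h
... | yes a<h rewrite distanceRank-lower a<h | ⌈1+n+n/2⌉≡1+n a =
  shiftOverlap-profile {K = suc a} prof t<p (s≤s (+-mono-≤ a<h a<h))
... | no a≮h rewrite distanceRank-upper (≮⇒≥ a≮h) | ⌈n+n/2⌉≡n (h + h ∸ a) = begin
  shiftOverlap p t (suc a)          ≡⟨ cong (λ y → shiftOverlap p t y) (sym p∸K≡1+a) ⟩
  shiftOverlap p t (p ∸ K)          ≡⟨ shiftOverlap-symmetric p 0<K (s≤s (m∸n≤m (h + h) a)) t<p ⟩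
  shiftOverlap p t K                ≡⟨ shiftOverlap-profile {K = K} prof t<p (s≤s (+-mono-≤ K≤h K≤h)) ⟩
  m + (τ ∸ K)                       ∎
  where
  open ≡-Reasoning
  p = suc (h + h)
  K = h + h ∸ a
  0<K : 0 < K
  0<K = m<n⇒0<n∸m a<2h
  K≤h : K ≤ h
  K≤h = ≤-trans (∸-monoʳ-≤ (h + h) (≮⇒≥ a≮h)) (≤-reflexive (m+n∸m≡n h h))
  p∸K≡1+a : p ∸ K ≡ suc a
  p∸K≡1+a = trans (+-∸-assoc 1 (m∸n≤m (h + h) a)) (cong suc (m∸[m∸n]≡n (<⇒≤ a<2h)))

weight-sums-realisable : ∀ h {t m τ} → Profile (suc (h + h)) t m τ → t < suc (h + h) →
  ∀ {s r} → suc s ≤ suc (h + h) →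
  suffixSum (weight m τ) (suc (h + h)) (suc s) ≤ r → r ≤ ∑ (suc s) (weight m τ) →
  Σ (Subset (suc (h + h))) λ A → ∣ A ∣ ≡ suc s × rABB (suc (h + h)) A t ≡ r
weight-sums-realisable h {t} {m} {τ} prof t<p {s} {r} s<p lo hi
  with WindowSums.window-sums-interpolate (weight-slowlyDescending m τ) (suc (h + h)) s<p lo hi
... | W , size≡ , sum≡ = fromPredicate p (inW ∘ distanceRank h) , card , value
  where
  open Window W
  p = suc (h + h)
  inW = window j a b
  card : ∣ fromPredicate p (inW ∘ distanceRank h) ∣ ≡ suc s
  card = begin
    ∣ fromPredicate p (inW ∘ distanceRank h) ∣        ≡⟨ ∣fromPredicate∣ p (inW ∘ distanceRank h) ⟩
    ∑[ x < p ] when (inW (distanceRank h x)) 1       ≡⟨ ∑-distanceRank h (λ i → when (inW i) 1) ⟩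
    ∑-over W (λ _ → 1)                               ≡⟨ size≡ ⟩
    suc s                                            ∎
    where open ≡-Reasoning
  value : rABB p (fromPredicate p (inW ∘ distanceRank h)) t ≡ r
  value = begin
    rABB p (fromPredicate p (inW ∘ distanceRank h)) t
      ≡⟨ rABB-fromPredicate p (inW ∘ distanceRank h) t ⟩
    ∑[ x < p ] when (inW (distanceRank h x)) (shiftOverlap p t x)
      ≡⟨ ∑-cong p (λ x x<p → cong (when (inW (distanceRank h x)))
                                  (shiftOverlap-distanceRank h prof t<p x<p)) ⟩
    ∑[ x < p ] when (inW (distanceRank h x)) (weight m τ (distanceRank h x))
      ≡⟨ ∑-distanceRank h (λ i → when (inW i) (weight m τ i)) ⟩
    ∑-over W (weight m τ)
      ≡⟨ sum≡ ⟩
    r ∎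
    where open ≡-Reasoning

n^2≡n*n : ∀ n → n ^ 2 ≡ n * n
n^2≡n*n n = cong (n *_) (*-identityʳ n)

2*n≡n+n : ∀ n → 2 * n ≡ n + n
2*n≡n+n n = cong (n +_) (+-identityʳ n)

[q*4+ρ]/4≡q : ∀ q {ρ} → ρ < 4 → (q * 4 + ρ) / 4 ≡ q
[q*4+ρ]/4≡q q {ρ} ρ<4 = begin
  (q * 4 + ρ) / 4    ≡⟨ +-distrib-/-∣ˡ ρ (divides-refl q) ⟩
  q * 4 / 4 + ρ / 4  ≡⟨ cong₂ _+_ (m*n/n≡m q 4) (m<n⇒m/n≡0 ρ<4) ⟩
  q + 0              ≡⟨ +-identityʳ q ⟩
  q                  ∎
  where open ≡-Reasoning

[x+k*4]/4≡x/4+k : ∀ x k → (x + k * 4) / 4 ≡ x / 4 + k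
[x+k*4]/4≡x/4+k x k = trans (+-distrib-/-∣ʳ x (divides-refl k)) (cong (x / 4 +_) (m*n/n≡m k 4))

data EvenOdd : ℕ → Set where
  even : ∀ k → EvenOdd (k + k)
  odd  : ∀ k → EvenOdd (suc (k + k))

evenOdd : ∀ n → EvenOdd n
evenOdd zero = even zero
evenOdd (suc n) with evenOdd n
... | even k = odd k
... | odd  k = subst EvenOdd (cong suc (+-suc k k)) (even (suc k))

[k+k]²/4≡k*k : ∀ k → (k + k) ^ 2 / 4 ≡ k * k
[k+k]²/4≡k*k k = trans (cong (_/ 4) (square k)) ([q*4+ρ]/4≡q (k * k) (s≤s z≤n))
  where
  square : ∀ k → (k + k) * ((k + k) * 1) ≡ k * k * 4 + 0
  square = solve-∀

[1+k+k]²/4≡k*k+k : ∀ k → suc (k + k) ^ 2 / 4 ≡ k * k + k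
[1+k+k]²/4≡k*k+k k = trans (cong (_/ 4) (square k)) ([q*4+ρ]/4≡q (k * k + k) (s≤s (s≤s z≤n)))
  where
  square : ∀ k → suc (k + k) * (suc (k + k) * 1) ≡ (k * k + k) * 4 + 1
  square = solve-∀

[1+n]²/4≡n²/4+⌈n/2⌉ : ∀ n → suc n ^ 2 / 4 ≡ n ^ 2 / 4 + ⌈ n /2⌉
[1+n]²/4≡n²/4+⌈n/2⌉ n with evenOdd n
... | even k = begin
  suc (k + k) ^ 2 / 4               ≡⟨ [1+k+k]²/4≡k*k+k k ⟩
  k * k + k                         ≡⟨ cong₂ _+_ (sym ([k+k]²/4≡k*k k)) (sym (⌈n+n/2⌉≡n k)) ⟩
  (k + k) ^ 2 / 4 + ⌈ k + k /2⌉     ∎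
  where open ≡-Reasoning
... | odd k = begin
  suc (suc (k + k)) ^ 2 / 4             ≡⟨ cong (λ x → x ^ 2 / 4) (cong suc (sym (+-suc k k))) ⟩
  (suc k + suc k) ^ 2 / 4               ≡⟨ [k+k]²/4≡k*k (suc k) ⟩
  suc k * suc k                         ≡⟨ regroup k ⟩
  k * k + k + suc k                     ≡⟨ cong₂ _+_ (sym ([1+k+k]²/4≡k*k+k k)) (sym (⌈1+n+n/2⌉≡1+n k)) ⟩
  suc (k + k) ^ 2 / 4 + ⌈ suc (k + k) /2⌉ ∎
  where
  open ≡-Reasoning
  regroup : ∀ k → suc k * suc k ≡ k * k + k + suc k
  regroup = solve-∀

⌈[N*4∸y]/4⌉+y/4≡N : ∀ N y → y ≤ N * 4 → (N * 4 ∸ y + 3) / 4 + y / 4 ≡ N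
⌈[N*4∸y]/4⌉+y/4≡N N y y≤4N = begin
  (N * 4 ∸ y + 3) / 4 + q     ≡⟨ cong (λ x → x / 4 + q) split ⟩
  (e * 4 + (3 ∸ ρ)) / 4 + q   ≡⟨ cong (_+ q) ([q*4+ρ]/4≡q e (s≤s (m∸n≤m 3 ρ))) ⟩
  e + q                       ≡⟨ m∸n+n≡m q≤N ⟩
  N                           ∎
  where
  open ≡-Reasoning
  q = y / 4
  ρ = y % 4
  e = N ∸ q
  q≤N : q ≤ N
  q≤N = *-cancelʳ-≤ q N 4 (≤-trans (m/n*n≤m y 4) y≤4N)
  ρ≤3 : ρ ≤ 3
  ρ≤3 = ≤-pred (m%n<n y 4)
  regroup : ∀ e q c ρ → (e + q) * 4 + (c + ρ) ≡ e * 4 + c + (ρ + q * 4)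
  regroup = solve-∀
  split : N * 4 ∸ y + 3 ≡ e * 4 + (3 ∸ ρ)
  split = +-cancelʳ-≡ y _ _ (begin
    N * 4 ∸ y + 3 + y               ≡⟨ xy∙z≈xz∙y (N * 4 ∸ y) 3 y ⟩
    N * 4 ∸ y + y + 3               ≡⟨ cong (_+ 3) (m∸n+n≡m y≤4N) ⟩
    N * 4 + 3                       ≡⟨ cong₂ (λ a b → a * 4 + b) (sym (m∸n+n≡m q≤N)) (sym (m∸n+n≡m ρ≤3)) ⟩
    (e + q) * 4 + ((3 ∸ ρ) + ρ)     ≡⟨ regroup e q (3 ∸ ρ) ρ ⟩
    e * 4 + (3 ∸ ρ) + (ρ + q * 4)   ≡⟨ cong (e * 4 + (3 ∸ ρ) +_) (sym (m≡m%n+[m/n]*n y 4)) ⟩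
    e * 4 + (3 ∸ ρ) + y             ∎)

⌈n[4t∸n]/4⌉+n²/4≡nt : ∀ n t → n ≤ t + t → (n * (4 * t ∸ n) + 3) / 4 + n ^ 2 / 4 ≡ n * t
⌈n[4t∸n]/4⌉+n²/4≡nt n t n≤2t = begin
  (n * (4 * t ∸ n) + 3) / 4 + n ^ 2 / 4
    ≡⟨ cong (λ x → (x + 3) / 4 + n ^ 2 / 4) (*-distribˡ-∸ n (4 * t) n) ⟩
  (n * (4 * t) ∸ n * n + 3) / 4 + n ^ 2 / 4
    ≡⟨ cong₂ (λ a b → (a ∸ b + 3) / 4 + n ^ 2 / 4) (reorder n t) (sym (n^2≡n*n n)) ⟩
  (n * t * 4 ∸ n ^ 2 + 3) / 4 + n ^ 2 / 4
    ≡⟨ ⌈[N*4∸y]/4⌉+y/4≡N (n * t) (n ^ 2) n²≤4nt ⟩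
  n * t ∎
  where
  open ≡-Reasoning
  reorder : ∀ n t → n * (4 * t) ≡ n * t * 4
  reorder = solve-∀
  n²≤4nt : n ^ 2 ≤ n * t * 4
  n²≤4nt = subst₂ _≤_ (sym (n^2≡n*n n)) (quadruple n t) (*-monoʳ-≤ n (≤-trans n≤2t (m≤m+n (t + t) (t + t))))
    where
    quadruple : ∀ n t → n * (t + t + (t + t)) ≡ n * t * 4
    quadruple = solve-∀

[2t∸n]²/4+nt≡t*t+n²/4 : ∀ n t → n ≤ t + t → (2 * t ∸ n) ^ 2 / 4 + n * t ≡ t * t + n ^ 2 / 4
[2t∸n]²/4+nt≡t*t+n²/4 n t n≤2t = begin
  e ^ 2 / 4 + n * t                  ≡⟨ sym ([x+k*4]/4≡x/4+k (e ^ 2) (n * t)) ⟩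
  (e ^ 2 + n * t * 4) / 4            ≡⟨ cong (_/ 4) expand ⟩
  (n ^ 2 + t * t * 4) / 4            ≡⟨ [x+k*4]/4≡x/4+k (n ^ 2) (t * t) ⟩
  n ^ 2 / 4 + t * t                  ≡⟨ +-comm (n ^ 2 / 4) (t * t) ⟩
  t * t + n ^ 2 / 4                  ∎
  where
  open ≡-Reasoning
  e = 2 * t ∸ n
  n+e≡2t : n + e ≡ 2 * t
  n+e≡2t = m+[n∸m]≡n (≤-trans n≤2t (≤-reflexive (sym (2*n≡n+n t))))
  step₁ : ∀ e n t → e * (e * 1) + n * t * 4 ≡ e * (e * 1) + 2 * n * (2 * t)
  step₁ = solve-∀
  step₂ : ∀ e n → e * (e * 1) + 2 * n * (n + e) ≡ n * (n * 1) + (n + e) * (n + e)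
  step₂ = solve-∀
  step₃ : ∀ n t → n * (n * 1) + 2 * t * (2 * t) ≡ n * (n * 1) + t * t * 4
  step₃ = solve-∀
  expand : e ^ 2 + n * t * 4 ≡ n ^ 2 + t * t * 4
  expand = begin
    e ^ 2 + n * t * 4                ≡⟨ step₁ e n t ⟩
    e ^ 2 + 2 * n * (2 * t)          ≡⟨ cong (λ x → e ^ 2 + 2 * n * x) (sym n+e≡2t) ⟩
    e ^ 2 + 2 * n * (n + e)          ≡⟨ step₂ e n ⟩
    n ^ 2 + (n + e) * (n + e)        ≡⟨ cong (λ x → n ^ 2 + x * x) n+e≡2t ⟩
    n ^ 2 + 2 * t * (2 * t)          ≡⟨ step₃ n t ⟩
    n ^ 2 + t * t * 4                ∎

-- The bounds f and g as weight sums

∑-capped-unsaturated : ∀ τ n → n ≤ τ + τ → ∑[ i < n ] (τ ∸ ⌈ i /2⌉) + n ^ 2 / 4 ≡ n * τ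
∑-capped-unsaturated τ zero    _     = refl
∑-capped-unsaturated τ (suc n) n<2τ = begin
  ∑ (suc n) C + suc n ^ 2 / 4
    ≡⟨ cong₂ _+_ (∑-suc n C) ([1+n]²/4≡n²/4+⌈n/2⌉ n) ⟩
  ∑ n C + (τ ∸ ⌈ n /2⌉) + (n ^ 2 / 4 + ⌈ n /2⌉)
    ≡⟨ interchange (∑ n C) _ _ _ ⟩
  ∑ n C + n ^ 2 / 4 + ((τ ∸ ⌈ n /2⌉) + ⌈ n /2⌉)
    ≡⟨ cong₂ _+_ (∑-capped-unsaturated τ n (<⇒≤ n<2τ)) (m∸n+n≡m half≤τ) ⟩
  n * τ + τ
    ≡⟨ +-comm (n * τ) τ ⟩
  suc n * τ ∎
  where
  open ≡-Reasoning
  C : ℕ → ℕ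
  C i = τ ∸ ⌈ i /2⌉
  half≤τ : ⌈ n /2⌉ ≤ τ
  half≤τ = ≤-trans (⌊n/2⌋-mono n<2τ) (≤-reflexive (sym (n≡⌊n+n/2⌋ τ)))

∑-capped-saturated : ∀ τ n → τ + τ ≤ suc n → ∑[ i < n ] (τ ∸ ⌈ i /2⌉) ≡ τ * τ
∑-capped-saturated zero     n _ = trans (∑-cong n (λ i _ → 0∸n≡0 ⌈ i /2⌉)) (trans (∑-const n 0) (*-zeroʳ n))
∑-capped-saturated (suc τ) n 2τ≤1+n = begin
  ∑ n C              ≡⟨ ∑-vanishing C k≤n beyond ⟩
  ∑ k C              ≡⟨ +-cancelʳ-≡ (τ * τ + τ) _ _ at-k ⟩
  suc τ * suc τ      ∎
  where
  open ≡-Reasoning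
  C : ℕ → ℕ
  C i = suc τ ∸ ⌈ i /2⌉
  k = suc (τ + τ)
  k≤n : k ≤ n
  k≤n = ≤-pred (subst (_≤ suc n) (cong suc (+-suc τ τ)) 2τ≤1+n)
  beyond : ∀ i → k ≤ i → C i ≡ 0
  beyond i k≤i = m≤n⇒m∸n≡0 (≤-trans (≤-reflexive (sym (⌈1+n+n/2⌉≡1+n τ))) (⌈n/2⌉-mono k≤i))
  regroup : ∀ τ → suc (τ + τ) * suc τ ≡ suc τ * suc τ + (τ * τ + τ)
  regroup = solve-∀
  at-k : ∑ k C + (τ * τ + τ) ≡ suc τ * suc τ + (τ * τ + τ)
  at-k = begin
    ∑ k C + (τ * τ + τ)            ≡⟨ cong (∑ k C +_) (sym ([1+k+k]²/4≡k*k+k τ)) ⟩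
    ∑ k C + k ^ 2 / 4              ≡⟨ ∑-capped-unsaturated (suc τ) k (s≤s (+-monoʳ-≤ τ (n≤1+n τ))) ⟩
    k * suc τ                      ≡⟨ regroup τ ⟩
    suc τ * suc τ + (τ * τ + τ)    ∎

∑-weight-split : ∀ m τ n → ∑[ i < n ] weight m τ i ≡ n * m + ∑[ i < n ] (τ ∸ ⌈ i /2⌉)
∑-weight-split m τ n = trans (∑-distrib-+ n (λ _ → m) _) (cong (_+ _) (∑-const n m))

∑-weight-unsaturated : ∀ m τ n → n ≤ τ + τ → ∑[ i < n ] weight m τ i + n ^ 2 / 4 ≡ n * (m + τ)
∑-weight-unsaturated m τ n n≤2τ = begin
  ∑[ i < n ] weight m τ i + n ^ 2 / 4                    ≡⟨ cong (_+ n ^ 2 / 4) (∑-weight-split m τ n) ⟩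
  n * m + ∑[ i < n ] (τ ∸ ⌈ i /2⌉) + n ^ 2 / 4           ≡⟨ +-assoc (n * m) _ _ ⟩
  n * m + (∑[ i < n ] (τ ∸ ⌈ i /2⌉) + n ^ 2 / 4)         ≡⟨ cong (n * m +_) (∑-capped-unsaturated τ n n≤2τ) ⟩
  n * m + n * τ                                          ≡⟨ sym (*-distribˡ-+ n m τ) ⟩
  n * (m + τ)                                            ∎
  where open ≡-Reasoning

∑-weight-saturated : ∀ m τ n → τ + τ ≤ suc n → ∑[ i < n ] weight m τ i ≡ n * m + τ * τ
∑-weight-saturated m τ n 2τ≤1+n =
  trans (∑-weight-split m τ n) (cong (n * m +_) (∑-capped-saturated τ n 2τ≤1+n))

long-square : ∀ m τ → (m + (τ + τ)) * m + τ * τ ≡ (m + τ) * (m + τ)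
long-square = solve-∀

∑-weight-total : ∀ {p t m τ} → Profile p t m τ → ∑[ i < p ] weight m τ i ≡ t * t
∑-weight-total {p} (short {t} 2t<p) =
  trans (∑-weight-saturated 0 t p (≤-trans (<⇒≤ 2t<p) (n≤1+n p))) (cong (_+ t * t) (*-zeroʳ p))
∑-weight-total (long {m} {τ} refl) =
  trans (∑-weight-saturated m τ (m + (τ + τ)) (≤-trans (m≤n+m (τ + τ) m) (n≤1+n _))) (long-square m τ)

rearrange : ∀ {a b} a′ b′ c d → a ≤ b → a′ + c ≡ a + d → b + d ≡ b′ + c → a′ ≤ b′
rearrange a′ b′ c d a≤b eq₁ eq₂ = +-cancelʳ-≤ c a′ b′ (subst₂ _≤_ (sym eq₁) eq₂ (+-monoˡ-≤ d a≤b))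

long-excess : ∀ m τ → 2 * (m + τ) ∸ (m + (τ + τ)) ≡ m
long-excess m τ = trans (cong (_∸ (m + (τ + τ))) (regroup m τ)) (m+n∸m≡n (m + (τ + τ)) m)
  where
  regroup : ∀ m τ → 2 * (m + τ) ≡ m + (τ + τ) + m
  regroup = solve-∀

g≡∑-weight : ∀ {p t m τ s} → Profile p t m τ → s < p → g p s t ≡ ∑[ i < s ] weight m τ i
g≡∑-weight {p} {t} {m} {τ} {s} prof s<p
  with (2 * t) ≤ᵇ s           | ≤ᵇ-reflects-≤ (2 * t) s
     | (2 * t + s + 1) ≤ᵇ (2 * p) | ≤ᵇ-reflects-≤ (2 * t + s + 1) (2 * p)
g≡∑-weight {s = s} (short {t} _) _ | true | ofʸ 2t≤s | _ | _ = begin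
  t ^ 2
    ≡⟨ n^2≡n*n t ⟩
  t * t
    ≡⟨ cong (_+ t * t) (sym (*-zeroʳ s)) ⟩
  s * 0 + t * t
    ≡⟨ sym (∑-weight-saturated 0 t s (≤-trans (subst (_≤ s) (2*n≡n+n t) 2t≤s) (n≤1+n s))) ⟩
  ∑[ i < s ] weight 0 t i ∎
  where open ≡-Reasoning
g≡∑-weight (long {m} {τ} refl) s<p | true | ofʸ 2t≤s | _ | _ =
  contradiction (≤-trans (s≤s 2t≤s) s<p) (≤⇒≯ (≤-trans (m≤m+n (m + (τ + τ)) m) (≤-reflexive (regroup m τ))))
  where
  regroup : ∀ m τ → m + (τ + τ) + m ≡ 2 * (m + τ)
  regroup = solve-∀
g≡∑-weight {p} {t} {m} {τ} {s} prof s<p | false | ofⁿ 2t≰s | true | ofʸ 2t+s<2p =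
  +-cancelʳ-≡ (s ^ 2 / 4) _ _ (begin
    (s * (4 * t ∸ s) + 3) / 4 + s ^ 2 / 4   ≡⟨ ⌈n[4t∸n]/4⌉+n²/4≡nt s t s≤2t ⟩
    s * t                                   ≡⟨ cong (s *_) (profile-t≡m+τ prof) ⟩
    s * (m + τ)                             ≡⟨ sym (∑-weight-unsaturated m τ s (s≤2τ prof 2t≰s 2t+s<2p)) ⟩
    ∑[ i < s ] weight m τ i + s ^ 2 / 4     ∎)
  where
  open ≡-Reasoning
  below-double : ∀ {t} → ¬ (2 * t ≤ s) → s ≤ t + t
  below-double {t} 2t≰s = subst (s ≤_) (2*n≡n+n t) (<⇒≤ (≰⇒> 2t≰s))
  s≤2t : s ≤ t + t
  s≤2t = below-double {t} 2t≰s
  s≤2τ : ∀ {p t m τ} → Profile p t m τ → ¬ (2 * t ≤ s) → 2 * t + s + 1 ≤ 2 * p → s ≤ τ + τ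
  s≤2τ (short {t} _)        2t≰s _        = below-double {t} 2t≰s
  s≤2τ (long {m} {τ} refl)  _    2t+s<2p  =
    <⇒≤ (rearrange (suc s) (τ + τ) (2 * (m + τ)) 0 2t+s<2p (lhs m τ s) (rhs m τ))
    where
    lhs : ∀ m τ s → suc s + 2 * (m + τ) ≡ 2 * (m + τ) + s + 1 + 0
    lhs = solve-∀
    rhs : ∀ m τ → 2 * (m + (τ + τ)) + 0 ≡ τ + τ + 2 * (m + τ)
    rhs = solve-∀
g≡∑-weight {p} {s = s} (short {t} 2t<p) s<p | false | ofⁿ _ | false | ofⁿ 2t+s≮2p =
  contradiction (begin
    2 * t + s + 1          ≤⟨ n≤1+n _ ⟩
    suc (2 * t + s + 1)    ≡⟨ regroup t s ⟩
    suc (t + t) + suc s    ≤⟨ +-mono-≤ 2t<p s<p ⟩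
    p + p                  ≡⟨ sym (2*n≡n+n p) ⟩
    2 * p                  ∎) 2t+s≮2p
  where
  open ≤-Reasoning
  regroup : ∀ t s → suc (2 * t + s + 1) ≡ suc (t + t) + suc s
  regroup = solve-∀
g≡∑-weight {s = s} (long {m} {τ} refl) s<p | false | ofⁿ _ | false | ofⁿ 2t+s≮2p = begin
  s * (2 * (m + τ) ∸ (m + (τ + τ))) + (m + (τ + τ) ∸ (m + τ)) ^ 2
    ≡⟨ cong₂ (λ x y → s * x + y ^ 2) (long-excess m τ) (deficit m τ) ⟩
  s * m + τ ^ 2
    ≡⟨ cong (s * m +_) (n^2≡n*n τ) ⟩
  s * m + τ * τ
    ≡⟨ sym (∑-weight-saturated m τ s (≤-trans 2τ≤s (n≤1+n s))) ⟩
  ∑[ i < s ] weight m τ i ∎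
  where
  open ≡-Reasoning
  2τ≤s : τ + τ ≤ s
  2τ≤s = rearrange (τ + τ) s (2 * (m + τ) + 1) 0 (≰⇒> 2t+s≮2p) (lhs m τ) (rhs m τ s)
    where
    lhs : ∀ m τ → τ + τ + (2 * (m + τ) + 1) ≡ suc (2 * (m + (τ + τ))) + 0
    lhs = solve-∀
    rhs : ∀ m τ s → 2 * (m + τ) + s + 1 + 0 ≡ s + (2 * (m + τ) + 1)
    rhs = solve-∀
  deficit : ∀ m τ → m + (τ + τ) ∸ (m + τ) ≡ τ
  deficit m τ = trans (cong (_∸ (m + τ)) (sym (+-assoc m τ τ))) (m+n∸m≡n (m + τ) τ)

f+∑-weight≡t*t : ∀ {p t m τ s s′} → Profile p t m τ → 1 ≤ s → s + s′ ≡ p →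
  f p s t + ∑[ i < s′ ] weight m τ i ≡ t * t
f+∑-weight≡t*t {p} {t} {m} {τ} {s} {s′} prof 1≤s E
  with (2 * t + s) ≤ᵇ (p + 1) | ≤ᵇ-reflects-≤ (2 * t + s) (p + 1)
     | (2 * t + 2) ≤ᵇ (p + s)   | ≤ᵇ-reflects-≤ (2 * t + 2) (p + s)
f+∑-weight≡t*t {s = s} {s′} (short {t} _) 1≤s refl | true | ofʸ 2t+s≤p+1 | _ | _ = begin
  ∑[ i < s′ ] weight 0 t i     ≡⟨ ∑-weight-saturated 0 t s′ 2t≤1+s′ ⟩
  s′ * 0 + t * t               ≡⟨ cong (_+ t * t) (*-zeroʳ s′) ⟩
  t * t                        ∎
  where
  open ≡-Reasoning
  lhs : ∀ t s → t + t + s ≡ 2 * t + s + 0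
  lhs = solve-∀
  rhs : ∀ s s′ → s + s′ + 1 + 0 ≡ suc s′ + s
  rhs = solve-∀
  2t≤1+s′ : t + t ≤ suc s′
  2t≤1+s′ = rearrange (t + t) (suc s′) s 0 2t+s≤p+1 (lhs t s) (rhs s s′)
-- reachable only with m = 0, that is for even p
f+∑-weight≡t*t {s = s} {s′} (long {m} {τ} refl) 1≤s E | true | ofʸ 2t+s≤p+1 | _ | _ = begin
  ∑[ i < s′ ] weight m τ i     ≡⟨ ∑-weight-saturated m τ s′ 2τ≤1+s′ ⟩
  s′ * m + τ * τ               ≡⟨ cong (λ x → s′ * x + τ * τ) m≡0 ⟩
  s′ * 0 + τ * τ               ≡⟨ cong (_+ τ * τ) (*-zeroʳ s′) ⟩
  τ * τ                        ≡⟨ cong (λ x → (x + τ) * (x + τ)) (sym m≡0) ⟩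
  (m + τ) * (m + τ)            ∎
  where
  open ≡-Reasoning
  lhs : ∀ m τ s → m + s + (m + (τ + τ)) ≡ 2 * (m + τ) + s + 0
  lhs = solve-∀
  rhs : ∀ m τ → m + (τ + τ) + 1 + 0 ≡ 1 + (m + (τ + τ))
  rhs = solve-∀
  m+s≤1 : m + s ≤ 1
  m+s≤1 = rearrange (m + s) 1 (m + (τ + τ)) 0 2t+s≤p+1 (lhs m τ s) (rhs m τ)
  m≡0 : m ≡ 0
  m≡0 = n≤0⇒n≡0 (+-cancelʳ-≤ 1 m 0 (≤-trans (+-monoʳ-≤ m 1≤s) m+s≤1))
  2τ≤1+s′ : τ + τ ≤ suc s′
  2τ≤1+s′ = ≤-trans (m≤n+m (τ + τ) m)
              (≤-trans (≤-reflexive (sym E)) (+-monoˡ-≤ s′ (≤-trans (m≤n+m s m) m+s≤1)))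
f+∑-weight≡t*t {p} {t} {m} {τ} {s} {s′} prof 1≤s E | false | ofⁿ 2t+s≰p+1 | true | ofʸ 2t+2≤p+s =
  +-cancelʳ-≡ (s′ ^ 2 / 4) _ _ (begin
    (s + 2 * t ∸ p) ^ 2 / 4 + ∑[ i < s′ ] weight m τ i + s′ ^ 2 / 4
      ≡⟨ cong (λ x → x ^ 2 / 4 + ∑[ i < s′ ] weight m τ i + s′ ^ 2 / 4) shifted ⟩
    (2 * t ∸ s′) ^ 2 / 4 + ∑[ i < s′ ] weight m τ i + s′ ^ 2 / 4
      ≡⟨ +-assoc ((2 * t ∸ s′) ^ 2 / 4) _ _ ⟩
    (2 * t ∸ s′) ^ 2 / 4 + (∑[ i < s′ ] weight m τ i + s′ ^ 2 / 4)
      ≡⟨ cong ((2 * t ∸ s′) ^ 2 / 4 +_) (∑-weight-unsaturated m τ s′ (s′≤2τ prof E 2t+s≰p+1 2t+2≤p+s)) ⟩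
    (2 * t ∸ s′) ^ 2 / 4 + s′ * (m + τ)
      ≡⟨ cong (λ x → (2 * t ∸ s′) ^ 2 / 4 + s′ * x) (sym (profile-t≡m+τ prof)) ⟩
    (2 * t ∸ s′) ^ 2 / 4 + s′ * t
      ≡⟨ [2t∸n]²/4+nt≡t*t+n²/4 s′ t (s′≤2t {t = t} E 2t+s≰p+1) ⟩
    t * t + s′ ^ 2 / 4 ∎)
  where
  open ≡-Reasoning
  shifted : s + 2 * t ∸ p ≡ 2 * t ∸ s′
  shifted = trans (cong (s + 2 * t ∸_) (sym E)) ([m+n]∸[m+o]≡n∸o s (2 * t) s′)
  s′+2≤2t : ∀ {p t} → s + s′ ≡ p → ¬ (2 * t + s ≤ p + 1) → s′ + 2 ≤ t + t
  s′+2≤2t {t = t} refl 2t+s≰p+1 = rearrange (s′ + 2) (t + t) s 0 (≰⇒> 2t+s≰p+1) (lhs s s′) (rhs t s)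
    where
    lhs : ∀ s s′ → s′ + 2 + s ≡ suc (s + s′ + 1) + 0
    lhs = solve-∀
    rhs : ∀ t s → 2 * t + s + 0 ≡ t + t + s
    rhs = solve-∀
  s′≤2t : ∀ {p t} → s + s′ ≡ p → ¬ (2 * t + s ≤ p + 1) → s′ ≤ t + t
  s′≤2t {t = t} E 2t+s≰p+1 = ≤-trans (m≤m+n s′ 2) (s′+2≤2t {t = t} E 2t+s≰p+1)
  s′≤2τ : ∀ {p t m τ} → Profile p t m τ → s + s′ ≡ p → ¬ (2 * t + s ≤ p + 1) → 2 * t + 2 ≤ p + s → s′ ≤ τ + τ
  s′≤2τ (short {t} _) E 2t+s≰p+1 _ = s′≤2t {t = t} E 2t+s≰p+1
  s′≤2τ (long {m} {τ} refl) E _ 2t+2≤p+s =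
    ≤-trans (m≤m+n s′ 2) (rearrange (s′ + 2) (τ + τ) (2 * (m + τ)) 0 doubled (lhs m τ s′) (rhs m τ))
    where
    doubled : 2 * (m + τ) + 2 + s′ ≤ m + (τ + τ) + (m + (τ + τ))
    doubled = ≤-trans (+-monoˡ-≤ s′ 2t+2≤p+s)
                (≤-reflexive (trans (+-assoc (m + (τ + τ)) s s′) (cong (m + (τ + τ) +_) E)))
    lhs : ∀ m τ s′ → s′ + 2 + 2 * (m + τ) ≡ 2 * (m + τ) + 2 + s′ + 0
    lhs = solve-∀
    rhs : ∀ m τ → m + (τ + τ) + (m + (τ + τ)) + 0 ≡ τ + τ + 2 * (m + τ)
    rhs = solve-∀
f+∑-weight≡t*t {s = s} {s′} (short {t} 2t<p) 1≤s refl | false | ofⁿ _ | false | ofⁿ 2t+2≰p+s =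
  contradiction (subst (_≤ s + s′ + s) (regroup t) (+-mono-≤ 2t<p 1≤s)) 2t+2≰p+s
  where
  regroup : ∀ t → suc (t + t) + 1 ≡ 2 * t + 2
  regroup = solve-∀
f+∑-weight≡t*t {s = s} {s′} (long {m} {τ} refl) 1≤s E | false | ofⁿ _ | false | ofⁿ 2t+2≰p+s = begin
  s * (2 * (m + τ) ∸ (m + (τ + τ))) + ∑[ i < s′ ] weight m τ i
    ≡⟨ cong₂ (λ x y → s * x + y) (long-excess m τ) (∑-weight-saturated m τ s′ 2τ≤1+s′) ⟩
  s * m + (s′ * m + τ * τ)
    ≡⟨ sym (+-assoc (s * m) (s′ * m) (τ * τ)) ⟩
  s * m + s′ * m + τ * τ
    ≡⟨ cong (_+ τ * τ) (sym (*-distribʳ-+ m s s′)) ⟩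
  (s + s′) * m + τ * τ
    ≡⟨ cong (λ x → x * m + τ * τ) E ⟩
  (m + (τ + τ)) * m + τ * τ
    ≡⟨ long-square m τ ⟩
  (m + τ) * (m + τ) ∎
  where
  open ≡-Reasoning
  doubled : suc (m + (τ + τ) + (m + (τ + τ))) ≤ 2 * (m + τ) + 2 + s′
  doubled = ≤-trans (≤-reflexive (cong suc (sym (trans (+-assoc (m + (τ + τ)) s s′)
                                                        (cong (m + (τ + τ) +_) E)))))
                    (+-monoˡ-≤ s′ (≰⇒> 2t+2≰p+s))
  lhs : ∀ m τ → τ + τ + (2 * (m + τ) + 1) ≡ suc (m + (τ + τ) + (m + (τ + τ))) + 0
  lhs = solve-∀
  rhs : ∀ m τ s′ → 2 * (m + τ) + 2 + s′ + 0 ≡ suc s′ + (2 * (m + τ) + 1)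
  rhs = solve-∀
  2τ≤1+s′ : τ + τ ≤ suc s′
  2τ≤1+s′ = rearrange (τ + τ) (suc s′) (2 * (m + τ) + 1) 0 doubled (lhs m τ) (rhs m τ s′)

suffixSum-weight≡f : ∀ {p t m τ s} → Profile p t m τ → 1 ≤ s → s ≤ p → suffixSum (weight m τ) p s ≡ f p s t
suffixSum-weight≡f {p} {t} {m} {τ} {s} prof 1≤s s≤p = +-cancelˡ-≡ (∑ (p ∸ s) (weight m τ)) _ _ (begin
  ∑ (p ∸ s) (weight m τ) + suffixSum (weight m τ) p s  ≡⟨ ∑-prefix+suffix (weight m τ) s≤p ⟩
  ∑ p (weight m τ)                                     ≡⟨ ∑-weight-total prof ⟩
  t * t                                                ≡⟨ sym (f+∑-weight≡t*t prof 1≤s (m+[n∸m]≡n s≤p)) ⟩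
  f p s t + ∑ (p ∸ s) (weight m τ)                     ≡⟨ +-comm (f p s t) _ ⟩
  ∑ (p ∸ s) (weight m τ) + f p s t                     ∎)
  where open ≡-Reasoning

realisable : ∀ h {s t r} → 1 ≤ s → s ≤ h + h → t ≤ h + h →
  f (suc (h + h)) s t ≤ r → r ≤ g (suc (h + h)) s t →
  Σ (Subset (suc (h + h))) λ A → ∣ A ∣ ≡ s × rABB (suc (h + h)) A t ≡ r
realisable h {suc s} {t} {r} 1≤s s≤2h t≤2h f≤r r≤g with profile h t t≤2h
... | m , τ , prof = weight-sums-realisable h prof (s≤s t≤2h) s≤p
  (subst (_≤ r) (sym (suffixSum-weight≡f prof 1≤s s≤p)) f≤r)
  (subst (r ≤_) (g≡∑-weight prof (s≤s s≤2h)) r≤g)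
  where
  s≤p : suc s ≤ suc (h + h)
  s≤p = ≤-trans s≤2h (n≤1+n (h + h))

odd-halves : ∀ p → p % 2 ≡ 1 → p ≡ suc (p / 2 + p / 2)
odd-halves p p%2≡1 = begin
  p                        ≡⟨ m≡m%n+[m/n]*n p 2 ⟩
  p % 2 + p / 2 * 2        ≡⟨ cong₂ _+_ p%2≡1 (trans (*-comm (p / 2) 2) (2*n≡n+n (p / 2))) ⟩
  suc (p / 2 + p / 2)      ∎
  where open ≡-Reasoning

theorem7 : (p : ℕ) .{{_ : NonZero p}} → p % 2 ≡ 1 →
    (s t : ℕ) → 1 ≤ s → s ≤ p ∸ 1 → 1 ≤ t → t ≤ p ∸ 1 →
    (r : ℕ) → f p s t ≤ r → r ≤ g p s t →
    Σ (Subset p) (λ A → (∣ A ∣ ≡ s) × (rABB p A t ≡ r))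
theorem7 p p%2≡1 s t 1≤s s≤p-1 _ t≤p-1 r f≤r r≤g with p / 2 | odd-halves p p%2≡1
... | h | refl = realisable h 1≤s s≤p-1 t≤p-1 f≤r r≤g
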